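{- For an integer $k\ge 2$, let $m_k=2^{2^k-1}F_1F_2\cdots F_{k-1}$, where $F_j=2^{2^j}+1$ is the $j$-th Fermat number. Then $m_k$ is imperfect, i.e. $2\beta(m_k)=m_k$, if and only if $k\in\{2,3,4,5\}$.
   Context: $\beta$ denotes the alternating sum-of-divisors function: the multiplicative arithmetic function with $\beta(1)=1$ and $\beta(p^a)=p^a-p^{a-1}+p^{a-2}-\cdots+(-1)^a$ for every prime power $p^a$ ($a\ge 1$); equivalently $\beta(n)=\sum_{d\mid n} d\,\lambda(n/d)$, where $\lambda$ is the Liouville function. A positive integer $n$ is called imperfect if $2\beta(n)=n$. -}

module Defs where

open import Data.Nat using (ℕ; zero; suc; _+_; _*_; _^_; _∸_; _≟_)
open import Data.Nat.Divisibility using (_∣_; _∣?_)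
open import Data.Product using (_,_; proj₁; proj₂)
open import Relation.Binary.PropositionalEquality using (_≡_)
open import Data.Nat.Primality using (prime?)
open import Data.Integer using (ℤ; +_; -_)
import Data.Integer as ℤ
open import Data.List using (_++_; List; []; _∷_; filter; map; length; sum; foldr; concatMap)
open import Data.Bool using (if_then_else_)
open import Relation.Nullary.Decidable using (⌊_⌋; _×-dec_)

range1 : ℕ → List ℕ
range1 zero = []
range1 (suc n) = range1 n ++ (suc n ∷ [])

-- Ω(n): number of prime factors of n counted with multiplicity,
-- = #{ (p , a) : p prime, a ≥ 1, p ^ a ∣ n }  (for n ≥ 1; p, a ≤ n suffice)
bigOmega : ℕ → ℕ
bigOmega n = length (filter (λ pa → prime? (proj₁ pa) ×-dec
                                    ((proj₁ pa ^ proj₂ pa) ∣? n))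
                   (concatMap (λ p → map (λ a → p , a) (range1 n)) (range1 n)))

liouville : ℕ → ℤ
liouville n = (ℤ.- (+ 1)) ℤ.^ bigOmega n

divisors : ℕ → List ℕ
divisors n = filter (λ d → d ∣? n) (range1 n)

-- n / d for d ∣ n, d ≥ 1 (computed by search; exact when d ∣ n, n ≥ 1)
quot : ℕ → ℕ → ℕ
quot n d = foldr (λ e acc → if ⌊ (d * e) ≟ n ⌋ then e else acc) 0 (range1 n)

beta : ℕ → ℤ
beta n = foldr ℤ._+_ (+ 0) (map (λ d → (+ d) ℤ.* liouville (quot n d)) (divisors n))

Imperfect : ℕ → Set
Imperfect n = (+ 2) ℤ.* beta n ≡ (+ n)

fermat : ℕ → ℕ
fermat j = 2 ^ (2 ^ j) + 1

fermatProd : ℕ → ℕ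
fermatProd zero = 1
fermatProd (suc zero) = 1
fermatProd (suc (suc j)) = fermatProd (suc j) * fermat (suc j)

m : ℕ → ℕ
m k = 2 ^ (2 ^ k ∸ 1) * fermatProd k

module Submission where

-- β n = Σ_{d ∣ n} d λ(n / d) is multiplicative, with β(p ^ j) = Σ_{i ≤ j} p ^ i (-1) ^ (j - i).
-- This is derived from the list-based definitions: sums over duplicate-free lists are reindexed
-- along bijections; Ω (hence λ) is additive on coprime factors with Ω(p ^ j) = j; and for coprime
-- a, b the divisors of a · b are exactly the products of a divisor of a and a divisor of b.
-- Fermat numbers satisfy F_j ≡ 2 (mod F_i) for i < j, so they are odd and pairwise coprime;
-- hence each F_i (1 ≤ i < k) splits off m_k as a coprime factor, and 3 = F_0 is coprime to m_k.
-- For 2 ≤ k ≤ 5 the numbers F_1, …, F_4 are prime, so β(m_k) = β(2 ^ (2 ^ k - 1)) · Π (F_j - 1)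
-- and 2 β(m_k) = m_k is a finite evaluation.  For k ≥ 6, F_5 = 641 · 6700417 is a coprime
-- factor of m_k with β(F_5) = 640 · 6700416 divisible by 3, so imperfection would force
-- 3 ∣ 2 β(m_k) = m_k.

open import Defs
open import Algebra.Properties.CommutativeSemigroup using (interchange; x∙yz≈y∙xz)
open import Data.Bool using (Bool; true; not; _∧_; T; if_then_else_)
open import Data.Bool.Properties using (T-∧)
open import Data.Empty using (⊥; ⊥-elim)
open import Data.Integer using (ℤ; +_; -_) renaming (∣_∣ to abs; _+_ to _+ℤ_; _*_ to _*ℤ_; _^_ to _^ℤ_)
import Data.Integer.Properties as ℤ
open import Data.List using (List; []; _∷_; _++_; map; foldr; filter; length; concatMap; cartesianProduct; upTo)
open import Data.List.Properties using (filter-all; filter-accept; filter-reject; length-++; length-upTo)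
open import Data.List.Membership.Propositional using (_∈_)
open import Data.List.Membership.Propositional.Properties
  using (∈-filter⁺; ∈-filter⁻; ∈-++⁺ˡ; ∈-++⁺ʳ; ∈-++⁻;
         ∈-cartesianProduct⁺; ∈-cartesianProduct⁻; ∈-upTo⁺; ∈-upTo⁻)
open import Data.List.Relation.Unary.All as All using ([])
open import Data.List.Relation.Unary.AllPairs using ([]; _∷_)
open import Data.List.Relation.Unary.Any using (here; there)
open import Data.List.Relation.Unary.Unique.Propositional using (Unique)
import Data.List.Relation.Unary.Unique.Propositional.Properties as Unique
open import Data.Nat
  using (ℕ; zero; suc; _+_; _*_; _^_; _∸_; _≤_; _<_; _≥_; _<ᵇ_; _≟_; z≤n; s≤s;
         NonZero; NonTrivial; >-nonZero; ≢-nonZero; nonTrivial⇒n>1)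
open import Data.Nat.Properties
open import Data.Nat.Coprimality using (Coprime; coprime-divisor; coprime-/gcd)
import Data.Nat.Coprimality as Coprime
open import Data.Nat.Divisibility
open import Data.Nat.GCD using (gcd; gcd[m,n]∣m; gcd[m,n]∣n; gcd[m,n]≢0)
open import Data.Nat.Primality
  using (Prime; prime?; prime[2]; ¬prime[1]; prime⇒nonZero; prime⇒nonTrivial; prime⇒irreducible;
         _Rough_; 2-rough; ∤⇒rough-suc; rough∧square>⇒prime)
open import Data.Nat.Tactic.RingSolver using (solve-∀)
open import Data.Product using (∃-syntax; _×_; _,_; proj₁; proj₂)
open import Data.Product.Properties using (≡-dec)
open import Data.Sum using (_⊎_; inj₁; inj₂; [_,_]′)
open import Function using (_∘_)
open import Function.Bundles using (Equivalence; _⇔_; mk⇔)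
open import Relation.Binary.Definitions using (DecidableEquality)
open import Relation.Binary.PropositionalEquality
open import Relation.Nullary using (¬_; ¬?; yes; no)
open import Relation.Nullary.Decidable using (⌊_⌋; _×-dec_; toWitnessFalse; from-yes; from-no)

x+[y+z]≡y+[x+z] : ∀ (x y z : ℤ) → x +ℤ (y +ℤ z) ≡ y +ℤ (x +ℤ z)
x+[y+z]≡y+[x+z] = x∙yz≈y∙xz ℤ.+-commutativeSemigroup

x*[y*z]≡y*[x*z] : ∀ x y z → x * (y * z) ≡ y * (x * z)
x*[y*z]≡y*[x*z] = x∙yz≈y∙xz *-commutativeSemigroup

[ab][cd]≡[ac][bd] : ∀ a b c d → (a * b) * (c * d) ≡ (a * c) * (b * d)
[ab][cd]≡[ac][bd] = interchange *-commutativeSemigroup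

[ab][cd]≡[ac][bd]ℤ : ∀ (a b c d : ℤ) → (a *ℤ b) *ℤ (c *ℤ d) ≡ (a *ℤ c) *ℤ (b *ℤ d)
[ab][cd]≡[ac][bd]ℤ = interchange ℤ.*-commutativeSemigroup

sumOver : {A : Set} → (A → ℤ) → List A → ℤ
sumOver f xs = foldr _+ℤ_ (+ 0) (map f xs)

module _ {A : Set} where

  sumOver-cong : ∀ {f g : A → ℤ} xs → (∀ {x} → x ∈ xs → f x ≡ g x) →
                 sumOver f xs ≡ sumOver g xs
  sumOver-cong []       _   = refl
  sumOver-cong (x ∷ xs) f≗g = cong₂ _+ℤ_ (f≗g (here refl)) (sumOver-cong xs (f≗g ∘ there))

  sumOver-++ : ∀ (f : A → ℤ) xs ys → sumOver f (xs ++ ys) ≡ sumOver f xs +ℤ sumOver f ys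
  sumOver-++ f []       ys = sym (ℤ.+-identityˡ _)
  sumOver-++ f (x ∷ xs) ys = trans (cong (f x +ℤ_) (sumOver-++ f xs ys)) (sym (ℤ.+-assoc (f x) _ _))

  sumOver-*ˡ : ∀ c (f : A → ℤ) xs → sumOver (λ x → c *ℤ f x) xs ≡ c *ℤ sumOver f xs
  sumOver-*ˡ c f []       = sym (ℤ.*-zeroʳ c)
  sumOver-*ˡ c f (x ∷ xs) = trans (cong (c *ℤ f x +ℤ_) (sumOver-*ˡ c f xs)) (sym (ℤ.*-distribˡ-+ c (f x) _))

  sumOver-one : ∀ (xs : List A) → sumOver (λ _ → + 1) xs ≡ + length xs
  sumOver-one []       = refl
  sumOver-one (x ∷ xs) = cong (+ 1 +ℤ_) (sumOver-one xs)

sumOver-cartesianProduct : ∀ {A B : Set} (f : A → ℤ) (g : B → ℤ) xs ys →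
  sumOver (λ xy → f (proj₁ xy) *ℤ g (proj₂ xy)) (cartesianProduct xs ys) ≡ sumOver f xs *ℤ sumOver g ys
sumOver-cartesianProduct f g []       ys = refl
sumOver-cartesianProduct f g (x ∷ xs) ys = begin
    sumOver F (map (x ,_) ys ++ cartesianProduct xs ys)
  ≡⟨ sumOver-++ F (map (x ,_) ys) _ ⟩
    sumOver F (map (x ,_) ys) +ℤ sumOver F (cartesianProduct xs ys)
  ≡⟨ cong₂ _+ℤ_ (trans (row ys) (sumOver-*ˡ (f x) g ys)) (sumOver-cartesianProduct f g xs ys) ⟩
    f x *ℤ sumOver g ys +ℤ sumOver f xs *ℤ sumOver g ys
  ≡⟨ sym (ℤ.*-distribʳ-+ (sumOver g ys) (f x) _) ⟩
    sumOver f (x ∷ xs) *ℤ sumOver g ys ∎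
  where
    open ≡-Reasoning
    F = λ xy → f (proj₁ xy) *ℤ g (proj₂ xy)
    row : ∀ zs → sumOver F (map (x ,_) zs) ≡ sumOver (λ y → f x *ℤ g y) zs
    row []       = refl
    row (z ∷ zs) = cong (f x *ℤ g z +ℤ_) (row zs)

record ListBijection {A B : Set} (h : A → B) (xs : List A) (ys : List B) : Set where
  field
    into      : ∀ {x} → x ∈ xs → h x ∈ ys
    onto      : ∀ {y} → y ∈ ys → ∃[ x ] x ∈ xs × h x ≡ y
    injective : ∀ {x x′} → x ∈ xs → x′ ∈ xs → h x ≡ h x′ → x ≡ x′

module Reindex {B : Set} (_≟_ : DecidableEquality B) where

  without : B → List B → List B
  without y = filter (λ z → ¬? (z ≟ y))

  sumOver-without : ∀ (f : B → ℤ) {y ys} → Unique ys → y ∈ ys → sumOver f ys ≡ f y +ℤ sumOver f (without y ys)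
  sumOver-without f {y} {.y ∷ ys} (y∉ys ∷ _) (here refl) =
    cong (f y +ℤ_) (trans (sym (cong (sumOver f) (filter-all (λ z → ¬? (z ≟ y)) (All.map (_∘ sym) y∉ys))))
                          (cong (sumOver f) (sym (filter-reject (λ z → ¬? (z ≟ y)) (λ ¬y≡y → ¬y≡y refl)))))
  sumOver-without f {y} {z ∷ ys} (z∉ys ∷ uniq) (there y∈ys) = begin
      f z +ℤ sumOver f ys
    ≡⟨ cong (f z +ℤ_) (sumOver-without f uniq y∈ys) ⟩
      f z +ℤ (f y +ℤ sumOver f (without y ys))
    ≡⟨ x+[y+z]≡y+[x+z] (f z) (f y) _ ⟩
      f y +ℤ (f z +ℤ sumOver f (without y ys))
    ≡⟨ cong (λ l → f y +ℤ sumOver f l) (sym (filter-accept (λ w → ¬? (w ≟ y)) (All.lookup z∉ys y∈ys))) ⟩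
      f y +ℤ sumOver f (without y (z ∷ ys)) ∎
    where open ≡-Reasoning

  sumOver-reindex : ∀ (f : B → ℤ) {A : Set} (h : A → B) xs ys → Unique xs → Unique ys →
                    ListBijection h xs ys → sumOver f ys ≡ sumOver (f ∘ h) xs
  sumOver-reindex f h [] [] _ _ _ = refl
  sumOver-reindex f h [] (y ∷ ys) _ _ bij with ListBijection.onto bij (here refl)
  ... | _ , () , _
  sumOver-reindex f h (x ∷ xs) ys (x∉xs ∷ uniq-xs) uniq-ys bij =
    trans (sumOver-without f uniq-ys (into (here refl)))
          (cong (f (h x) +ℤ_) (sumOver-reindex f h xs (without (h x) ys) uniq-xs
                                 (Unique.filter⁺ (λ z → ¬? (z ≟ h x)) uniq-ys) bij′))
    where
      open ListBijection bij
      hx′≢hx : ∀ {x′} → x′ ∈ xs → h x′ ≢ h x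
      hx′≢hx x′∈xs eq = All.lookup x∉xs x′∈xs (sym (injective (there x′∈xs) (here refl) eq))
      bij′ : ListBijection h xs (without (h x) ys)
      bij′ = record
        { into = λ x′∈xs → ∈-filter⁺ (λ z → ¬? (z ≟ h x)) (into (there x′∈xs)) (hx′≢hx x′∈xs)
        ; onto = λ y∈ → case-onto (∈-filter⁻ (λ z → ¬? (z ≟ h x)) y∈)
        ; injective = λ p q → injective (there p) (there q) }
        where
          case-onto : ∀ {y} → y ∈ ys × y ≢ h x → ∃[ x′ ] x′ ∈ xs × h x′ ≡ y
          case-onto (y∈ys , y≢hx) with onto y∈ys
          ... | _ , here refl , hx≡y = ⊥-elim (y≢hx (sym hx≡y))
          ... | x′ , there x′∈xs , hx′≡y = x′ , x′∈xs , hx′≡y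

  length-reindex : ∀ {A : Set} (h : A → B) xs ys → Unique xs → Unique ys →
                   ListBijection h xs ys → length ys ≡ length xs
  length-reindex h xs ys uniq-xs uniq-ys bij = ℤ.+-injective (begin
      + length ys                  ≡⟨ sumOver-one ys ⟨
      sumOver (λ _ → + 1) ys       ≡⟨ sumOver-reindex (λ _ → + 1) h xs ys uniq-xs uniq-ys bij ⟩
      sumOver (λ _ → + 1) xs       ≡⟨ sumOver-one xs ⟩
      + length xs                  ∎)
    where open ≡-Reasoning

divisor-pos : ∀ {n d} → 0 < n → d ∣ n → 0 < d
divisor-pos {d = zero}  0<n d∣n = ⊥-elim (<-irrefl (sym (0∣⇒≡0 d∣n)) 0<n)
divisor-pos {d = suc d} _   _   = s≤s z≤n

divisor-≤ : ∀ {n d} → 0 < n → d ∣ n → d ≤ n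
divisor-≤ 0<n = ∣⇒≤ {{>-nonZero 0<n}}

∈-range1⁻ : ∀ {n x} → x ∈ range1 n → 1 ≤ x × x ≤ n
∈-range1⁻ {suc n} x∈ with ∈-++⁻ (range1 n) x∈
... | inj₁ x∈range1n = proj₁ (∈-range1⁻ {n} x∈range1n) , m≤n⇒m≤1+n (proj₂ (∈-range1⁻ {n} x∈range1n))
... | inj₂ (here refl) = s≤s z≤n , ≤-refl

∈-range1⁺ : ∀ {n x} → 1 ≤ x → x ≤ n → x ∈ range1 n
∈-range1⁺ {zero}  (s≤s _) ()
∈-range1⁺ {suc n} {x} 1≤x x≤1+n with m≤n⇒m<n∨m≡n x≤1+n
... | inj₁ (s≤s x≤n) = ∈-++⁺ˡ (∈-range1⁺ 1≤x x≤n)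
... | inj₂ refl      = ∈-++⁺ʳ (range1 n) (here refl)

range1-unique : ∀ n → Unique (range1 n)
range1-unique zero    = []
range1-unique (suc n) = Unique.++⁺ (range1-unique n) ([] ∷ [])
  (λ { (x∈range1n , here refl) → <-irrefl refl (proj₂ (∈-range1⁻ {n} x∈range1n)) })

∈-divisors⁻ : ∀ {n d} → d ∈ divisors n → d ∣ n
∈-divisors⁻ {n} d∈ = proj₂ (∈-filter⁻ (_∣? n) {xs = range1 n} d∈)

∈-divisors⁺ : ∀ {n d} → 0 < n → d ∣ n → d ∈ divisors n
∈-divisors⁺ {n} 0<n d∣n = ∈-filter⁺ (_∣? n) (∈-range1⁺ (divisor-pos 0<n d∣n) (divisor-≤ 0<n d∣n)) d∣n

divisors-unique : ∀ n → Unique (divisors n)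
divisors-unique n = Unique.filter⁺ (_∣? n) (range1-unique n)

coprime-∣ : ∀ {a b x y} → Coprime a b → x ∣ a → y ∣ b → Coprime x y
coprime-∣ a⊥b x∣a y∣b (i∣x , i∣y) = a⊥b (∣-trans i∣x x∣a , ∣-trans i∣y y∣b)

coprime-* : ∀ {a b c} → Coprime a b → Coprime a c → Coprime a (b * c)
coprime-* a⊥b a⊥c (i∣a , i∣bc) = a⊥c (i∣a , coprime-divisor (coprime-∣ a⊥b i∣a ∣-refl) i∣bc)

coprime-1 : ∀ {a} → Coprime a 1
coprime-1 (_ , i∣1) = ∣1⇒≡1 i∣1

∣-^ : ∀ {p c} → 1 ≤ c → p ∣ p ^ c
∣-^ {p} {suc c} _ = m∣m*n (p ^ c)

prime∤⇒coprime : ∀ {p d} → Prime p → ¬ p ∣ d → Coprime d p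
prime∤⇒coprime pp p∤d (i∣d , i∣p) with prime⇒irreducible pp i∣p
... | inj₁ i≡1 = i≡1
... | inj₂ refl = ⊥-elim (p∤d i∣d)

module _ {p : ℕ} (pp : Prime p) where

  private instance
    p≢0 = prime⇒nonZero pp

  2≤p : 2 ≤ p
  2≤p = nonTrivial⇒n>1 p {{prime⇒nonTrivial pp}}

  ∣-primePower : ∀ {d} j → d ∣ p ^ j → ∃[ i ] i ≤ j × d ≡ p ^ i
  ∣-primePower zero    d∣1 = 0 , z≤n , ∣1⇒≡1 d∣1
  ∣-primePower {d} (suc j) d∣p^[1+j] with p ∣? d
  ... | yes (divides q refl) with ∣-primePower j (*-cancelˡ-∣ p (subst (_∣ p ^ suc j) (*-comm q p) d∣p^[1+j]))
  ...   | i , i≤j , refl = suc i , s≤s i≤j , *-comm (p ^ i) p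
  ∣-primePower {d} (suc j) d∣p^[1+j] | no p∤d
    with ∣-primePower j (coprime-divisor (prime∤⇒coprime pp p∤d) d∣p^[1+j])
  ... | i , i≤j , d≡p^i = i , m≤n⇒m≤1+n i≤j , d≡p^i

  ≤⇒^-∣-^ : ∀ {i j} → i ≤ j → p ^ i ∣ p ^ j
  ≤⇒^-∣-^ {i} {j} i≤j = divides (p ^ (j ∸ i))
    (trans (cong (p ^_) (sym (m∸n+n≡m i≤j))) (^-distribˡ-+-* p (j ∸ i) i))

  ^-∣-^⇒≤ : ∀ {i j} → p ^ i ∣ p ^ j → i ≤ j
  ^-∣-^⇒≤ {i} {j} p^i∣p^j with i ≤? j
  ... | yes i≤j = i≤j
  ... | no  i≰j = ⊥-elim (<⇒≱ (^-monoʳ-< p 2≤p (≰⇒> i≰j)) (divisor-≤ (m^n>0 p j) p^i∣p^j))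

  ^-injective : ∀ {i j} → p ^ i ≡ p ^ j → i ≡ j
  ^-injective p^i≡p^j = ≤-antisym (^-∣-^⇒≤ (∣-reflexive p^i≡p^j)) (^-∣-^⇒≤ (∣-reflexive (sym p^i≡p^j)))

  prime∣primePower : ∀ {q} c → Prime q → q ∣ p ^ c → q ≡ p
  prime∣primePower c pq q∣p^c with ∣-primePower c q∣p^c
  ... | zero  , _ , refl = ⊥-elim (¬prime[1] pq)
  ... | suc i , _ , refl with prime⇒irreducible pq (m∣m*n (p ^ i))
  ...   | inj₁ p≡1 = ⊥-elim (<-irrefl (sym p≡1) 2≤p)
  ...   | inj₂ p≡q = sym p≡q

  primePower-coprime : ∀ {y} c → ¬ p ∣ y → Coprime (p ^ c) y
  primePower-coprime c p∤y (i∣p^c , i∣y) with ∣-primePower c i∣p^c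
  ... | zero  , _ , i≡1    = i≡1
  ... | suc k , _ , refl = ⊥-elim (p∤y (∣-trans (m∣m*n (p ^ k)) i∣y))

open Reindex (≡-dec _≟_ _≟_) using (length-reindex)

n<m^n : ∀ {m} → 2 ≤ m → ∀ n → n < m ^ n
n<m^n 2≤m zero        = s≤s z≤n
n<m^n {m} 2≤m (suc n) = begin-strict
    suc n          ≤⟨ n<m^n 2≤m n ⟩
    m ^ n          <⟨ m<m+n (m ^ n) (≤-trans (s≤s z≤n) (n<m^n 2≤m n)) ⟩
    m ^ n + m ^ n  ≡⟨ cong (_+_ (m ^ n)) (sym (+-identityʳ (m ^ n))) ⟩
    2 * m ^ n      ≤⟨ *-monoˡ-≤ (m ^ n) 2≤m ⟩
    m * m ^ n      ∎
  where open ≤-Reasoning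

-- The list filtered in the definition of Ω: the pairs (p , c) with p prime, c ≥ 1 and
-- p ^ c ∣ n, so that bigOmega n = length (primePowersDividing n) by definition.
primePowersDividing : ℕ → List (ℕ × ℕ)
primePowersDividing n = filter (λ pc → prime? (proj₁ pc) ×-dec ((proj₁ pc ^ proj₂ pc) ∣? n))
  (concatMap (λ p → map (λ c → p , c) (range1 n)) (range1 n))

candidates≡cartesianProduct : ∀ (xs ys : List ℕ) →
  concatMap (λ p → map (λ c → p , c) ys) xs ≡ cartesianProduct xs ys
candidates≡cartesianProduct []       ys = refl
candidates≡cartesianProduct (x ∷ xs) ys = cong (map (x ,_) ys ++_) (candidates≡cartesianProduct xs ys)

primePowersDividing-unique : ∀ n → Unique (primePowersDividing n)
primePowersDividing-unique n = Unique.filter⁺ _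
  (subst Unique (sym (candidates≡cartesianProduct (range1 n) (range1 n)))
    (Unique.cartesianProduct⁺ (range1-unique n) (range1-unique n)))

-- Membership: for n > 0 the bounds p, c ≤ n of the candidates are automatic.
∈-primePowersDividing⁻ : ∀ {n p c} → (p , c) ∈ primePowersDividing n → Prime p × 1 ≤ c × p ^ c ∣ n
∈-primePowersDividing⁻ {n} pc∈ with ∈-filter⁻ _ {xs = concatMap _ (range1 n)} pc∈
... | pc∈candidates , pp , p^c∣n = pp , proj₁ (∈-range1⁻ {n} c∈range1) , p^c∣n
  where
    c∈range1 = proj₂ (∈-cartesianProduct⁻ (range1 n) (range1 n)
                 (subst (_ ∈_) (candidates≡cartesianProduct (range1 n) (range1 n)) pc∈candidates))

∈-primePowersDividing⁺ : ∀ {n p c} → 0 < n → Prime p → 1 ≤ c → p ^ c ∣ n → (p , c) ∈ primePowersDividing n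
∈-primePowersDividing⁺ {n} {p} {c} 0<n pp 1≤c p^c∣n = ∈-filter⁺ _
  (subst (_ ∈_) (sym (candidates≡cartesianProduct (range1 n) (range1 n)))
    (∈-cartesianProduct⁺ (∈-range1⁺ (≤-trans (s≤s z≤n) (2≤p pp)) (≤-trans p≤p^c p^c≤n))
                         (∈-range1⁺ 1≤c (≤-trans (<⇒≤ c<p^c) p^c≤n))))
  (pp , p^c∣n)
  where
    instance _ = prime⇒nonZero pp
    p^c≤n = divisor-≤ 0<n p^c∣n
    p≤p^c : p ≤ p ^ c
    p≤p^c = subst (_≤ p ^ c) (^-identityʳ p) (^-monoʳ-≤ p 1≤c)
    c<p^c : c < p ^ c
    c<p^c = n<m^n (2≤p pp) c

-- Ω (p ^ j) = j, the prime powers dividing p ^ j being p ^ 1, …, p ^ j.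
Ω-primePower : ∀ {p} → Prime p → ∀ j → bigOmega (p ^ j) ≡ j
Ω-primePower {p} pp j = trans
  (length-reindex (λ c → p , suc c) (upTo j) (primePowersDividing (p ^ j))
     (Unique.upTo⁺ j) (primePowersDividing-unique (p ^ j)) bijection)
  (length-upTo j)
  where
    instance _ = prime⇒nonZero pp
    onto : ∀ {qc} → qc ∈ primePowersDividing (p ^ j) → ∃[ c ] c ∈ upTo j × (p , suc c) ≡ qc
    onto {q , zero} qc∈ with ∈-primePowersDividing⁻ {p ^ j} qc∈
    ... | _ , () , _
    onto {q , suc c} qc∈ with ∈-primePowersDividing⁻ {p ^ j} qc∈
    ... | pq , 1≤c , q^c∣p^j with prime∣primePower pp j pq (∣-trans (∣-^ 1≤c) q^c∣p^j)
    ...   | refl = c , ∈-upTo⁺ (^-∣-^⇒≤ pp q^c∣p^j) , refl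
    bijection : ListBijection (λ c → p , suc c) (upTo j) (primePowersDividing (p ^ j))
    bijection = record
      { into      = λ c∈ → ∈-primePowersDividing⁺ (m^n>0 p j) pp (s≤s z≤n) (≤⇒^-∣-^ pp (∈-upTo⁻ c∈))
      ; onto      = onto
      ; injective = λ _ _ eq → suc-injective (cong proj₂ eq) }

-- Ω is additive on coprime factors: a prime power divides x * y iff it divides x or y,
-- and no prime power divides both.
Ω-* : ∀ {x y} → 0 < x → 0 < y → Coprime x y → bigOmega (x * y) ≡ bigOmega x + bigOmega y
Ω-* {x} {y} 0<x 0<y x⊥y = trans
  (length-reindex (λ pc → pc) (primePowersDividing x ++ primePowersDividing y) (primePowersDividing (x * y))
     (Unique.++⁺ (primePowersDividing-unique x) (primePowersDividing-unique y) disjoint)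
     (primePowersDividing-unique (x * y)) bijection)
  (length-++ (primePowersDividing x))
  where
    0<xy = *-mono-< 0<x 0<y
    not-common : ∀ {p} → Prime p → p ∣ x → p ∣ y → ⊥
    not-common pp p∣x p∣y = ¬prime[1] (subst Prime (x⊥y (p∣x , p∣y)) pp)
    disjoint : ∀ {pc} → ¬ (pc ∈ primePowersDividing x × pc ∈ primePowersDividing y)
    disjoint {p , c} (pc∈x , pc∈y) with ∈-primePowersDividing⁻ {x} pc∈x | ∈-primePowersDividing⁻ {y} pc∈y
    ... | pp , 1≤c , p^c∣x | _ , _ , p^c∣y = not-common pp (∣-trans (∣-^ 1≤c) p^c∣x) (∣-trans (∣-^ 1≤c) p^c∣y)
    into : ∀ {pc} → pc ∈ primePowersDividing x ++ primePowersDividing y → pc ∈ primePowersDividing (x * y)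
    into {p , c} pc∈ with ∈-++⁻ (primePowersDividing x) pc∈
    ... | inj₁ pc∈x with ∈-primePowersDividing⁻ {x} pc∈x
    ...   | pp , 1≤c , p^c∣x = ∈-primePowersDividing⁺ 0<xy pp 1≤c (∣-trans p^c∣x (m∣m*n y))
    into {p , c} pc∈ | inj₂ pc∈y with ∈-primePowersDividing⁻ {y} pc∈y
    ...   | pp , 1≤c , p^c∣y = ∈-primePowersDividing⁺ 0<xy pp 1≤c (∣-trans p^c∣y (n∣m*n x))
    onto : ∀ {pc} → pc ∈ primePowersDividing (x * y) →
           ∃[ pc′ ] pc′ ∈ primePowersDividing x ++ primePowersDividing y × pc′ ≡ pc
    onto {p , c} pc∈ with ∈-primePowersDividing⁻ {x * y} pc∈
    ... | pp , 1≤c , p^c∣xy with p ∣? x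
    ...   | yes p∣x = (p , c) , ∈-++⁺ˡ (∈-primePowersDividing⁺ 0<x pp 1≤c
              (coprime-divisor (primePower-coprime pp c (not-common pp p∣x))
                               (subst (p ^ c ∣_) (*-comm x y) p^c∣xy))) , refl
    ...   | no p∤x = (p , c) , ∈-++⁺ʳ (primePowersDividing x) (∈-primePowersDividing⁺ 0<y pp 1≤c
              (coprime-divisor (primePower-coprime pp c p∤x) p^c∣xy)) , refl
    bijection : ListBijection (λ pc → pc) (primePowersDividing x ++ primePowersDividing y)
                                          (primePowersDividing (x * y))
    bijection = record { into = into ; onto = onto ; injective = λ _ _ eq → eq }

-1ℤ : ℤ
-1ℤ = - (+ 1)

liouville-* : ∀ {x y} → 0 < x → 0 < y → Coprime x y → liouville (x * y) ≡ liouville x *ℤ liouville y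
liouville-* {x} {y} 0<x 0<y x⊥y =
  trans (cong (-1ℤ ^ℤ_) (Ω-* 0<x 0<y x⊥y)) (ℤ.^-distribˡ-+-* -1ℤ (bigOmega x) (bigOmega y))

liouville-primePower : ∀ {p} → Prime p → ∀ j → liouville (p ^ j) ≡ -1ℤ ^ℤ j
liouville-primePower pp j = cong (-1ℤ ^ℤ_) (Ω-primePower pp j)

open Reindex _≟_ using (sumOver-reindex)

-- quot n d searches a list for a cofactor e with d * e = n; for d ≠ 0 the cofactor
-- is unique, so the search returns it as soon as it occurs in the list.
search-finds-cofactor : ∀ {n d e} .{{_ : NonZero d}} (es : List ℕ) → e ∈ es → d * e ≡ n →
  foldr (λ e′ acc → if ⌊ d * e′ ≟ n ⌋ then e′ else acc) 0 es ≡ e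
search-finds-cofactor {n} {d} {e} (e′ ∷ es) e∈ de≡n with d * e′ ≟ n
... | yes de′≡n = *-cancelˡ-≡ e′ e d (trans de′≡n (sym de≡n))
... | no  de′≢n with e∈
...   | here refl = ⊥-elim (de′≢n de≡n)
...   | there e∈es = search-finds-cofactor es e∈es de≡n

quot-exact : ∀ {n} d {e} → 0 < n → d * e ≡ n → quot n d ≡ e
quot-exact {n} d {e} 0<n de≡n = search-finds-cofactor {{>-nonZero (divisor-pos 0<n d∣n)}} (range1 n)
  (∈-range1⁺ (divisor-pos 0<n e∣n) (divisor-≤ 0<n e∣n)) de≡n
  where
    d∣n = divides e (trans (sym de≡n) (*-comm d e))
    e∣n = divides d (sym de≡n)

term : ℕ → ℕ → ℤ
term n d = + d *ℤ liouville (quot n d)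

-- β(p ^ j) = Σ_{i ≤ j} p ^ i (-1) ^ (j - i).
altSum : ℕ → ℕ → ℤ
altSum p j = sumOver (λ i → + (p ^ i) *ℤ (-1ℤ ^ℤ (j ∸ i))) (upTo (suc j))

-- The divisors of p ^ j are the p ^ i, i ≤ j, with cofactor p ^ (j - i).
beta-primePower : ∀ {p} → Prime p → ∀ j → beta (p ^ j) ≡ altSum p j
beta-primePower {p} pp j = trans
  (sumOver-reindex (term (p ^ j)) (p ^_) (upTo (suc j)) (divisors (p ^ j))
     (Unique.upTo⁺ (suc j)) (divisors-unique (p ^ j)) bijection)
  (sumOver-cong (upTo (suc j)) summand)
  where
    instance _ = prime⇒nonZero pp
    0<p^j = m^n>0 p j
    onto : ∀ {d} → d ∈ divisors (p ^ j) → ∃[ i ] i ∈ upTo (suc j) × p ^ i ≡ d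
    onto d∈ with ∣-primePower pp j (∈-divisors⁻ d∈)
    ... | i , i≤j , d≡p^i = i , ∈-upTo⁺ (s≤s i≤j) , sym d≡p^i
    bijection : ListBijection (p ^_) (upTo (suc j)) (divisors (p ^ j))
    bijection = record
      { into      = λ { i∈ → ∈-divisors⁺ 0<p^j (≤⇒^-∣-^ pp (≤-pred (∈-upTo⁻ i∈))) }
      ; onto      = onto
      ; injective = λ _ _ → ^-injective pp }
    summand : ∀ {i} → i ∈ upTo (suc j) → term (p ^ j) (p ^ i) ≡ + (p ^ i) *ℤ (-1ℤ ^ℤ (j ∸ i))
    summand {i} i∈ = cong (+ (p ^ i) *ℤ_) (trans
      (cong liouville (quot-exact (p ^ i) 0<p^j (trans (sym (^-distribˡ-+-* p i (j ∸ i)))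
                                               (cong (p ^_) (m+[n∸m]≡n (≤-pred (∈-upTo⁻ i∈)))))))
      (liouville-primePower pp (j ∸ i)))

-- Every divisor x of a * b is d₁ * d₂ with d₁ ∣ a and d₂ ∣ b (take d₁ = gcd x a).
∣-*-split : ∀ {x a b} → 0 < a → x ∣ a * b → ∃[ d₁ ] ∃[ d₂ ] d₁ ∣ a × d₂ ∣ b × d₁ * d₂ ≡ x
∣-*-split {x} {a} {b} 0<a x∣ab = split (gcd[m,n]∣m x a) (gcd[m,n]∣n x a)
  where
    g = gcd x a
    instance
      g≢0 : NonZero g
      g≢0 = ≢-nonZero (gcd[m,n]≢0 x a (inj₂ (λ a≡0 → <-irrefl (sym a≡0) 0<a)))
    split : g ∣ x → g ∣ a → ∃[ d₁ ] ∃[ d₂ ] d₁ ∣ a × d₂ ∣ b × d₁ * d₂ ≡ x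
    split g∣x@(divides d₂ x≡d₂g) g∣a@(divides a′ a≡a′g) = g , d₂ , g∣a , d₂∣b , gd₂≡x
      where
        gd₂≡x : g * d₂ ≡ x
        gd₂≡x = trans (*-comm g d₂) (sym x≡d₂g)
        ab≡g[a′b] : a * b ≡ g * (a′ * b)
        ab≡g[a′b] = trans (cong (_* b) (trans a≡a′g (*-comm a′ g))) (*-assoc g a′ b)
        d₂⊥a′ : Coprime d₂ a′
        d₂⊥a′ = subst₂ Coprime (n/m≡quotient g∣x) (n/m≡quotient g∣a) (coprime-/gcd x a)
        d₂∣b : d₂ ∣ b
        d₂∣b = coprime-divisor d₂⊥a′ (*-cancelˡ-∣ g (subst₂ _∣_ (sym gd₂≡x) ab≡g[a′b] x∣ab))

module _ {a b : ℕ} (0<a : 0 < a) (0<b : 0 < b) (a⊥b : Coprime a b) where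

  private
    pairs = cartesianProduct (divisors a) (divisors b)

    ∈-pairs⁻ : ∀ {d₁ d₂} → (d₁ , d₂) ∈ pairs → d₁ ∣ a × d₂ ∣ b
    ∈-pairs⁻ d∈ with ∈-cartesianProduct⁻ (divisors a) (divisors b) d∈
    ... | d₁∈ , d₂∈ = ∈-divisors⁻ d₁∈ , ∈-divisors⁻ d₂∈

  divisorPairs-bijection : ListBijection (λ d → proj₁ d * proj₂ d) pairs (divisors (a * b))
  divisorPairs-bijection = record { into = into ; onto = onto ; injective = injective }
    where
      into : ∀ {d} → d ∈ pairs → proj₁ d * proj₂ d ∈ divisors (a * b)
      into {d₁ , d₂} d∈ = ∈-divisors⁺ (*-mono-< 0<a 0<b) (*-pres-∣ (proj₁ (∈-pairs⁻ d∈)) (proj₂ (∈-pairs⁻ d∈)))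
      onto : ∀ {x} → x ∈ divisors (a * b) → ∃[ d ] d ∈ pairs × proj₁ d * proj₂ d ≡ x
      onto x∈ with ∣-*-split 0<a (∈-divisors⁻ x∈)
      ... | d₁ , d₂ , d₁∣a , d₂∣b , d₁d₂≡x =
        (d₁ , d₂) , ∈-cartesianProduct⁺ (∈-divisors⁺ 0<a d₁∣a) (∈-divisors⁺ 0<b d₂∣b) , d₁d₂≡x
      -- d₁ ∣ e₁ e₂ with d₁ coprime to e₂ forces d₁ ∣ e₁, and symmetrically.
      injective : ∀ {d e} → d ∈ pairs → e ∈ pairs → proj₁ d * proj₂ d ≡ proj₁ e * proj₂ e → d ≡ e
      injective {d₁ , d₂} {e₁ , e₂} d∈ e∈ d₁d₂≡e₁e₂ with ∈-pairs⁻ d∈ | ∈-pairs⁻ e∈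
      ... | d₁∣a , d₂∣b | e₁∣a , e₂∣b = cong₂ _,_ d₁≡e₁
            (*-cancelˡ-≡ d₂ e₂ d₁ {{>-nonZero (divisor-pos 0<a d₁∣a)}} (trans d₁d₂≡e₁e₂ (cong (_* e₂) (sym d₁≡e₁))))
        where
          d₁∣e₁ = coprime-divisor (coprime-∣ a⊥b d₁∣a e₂∣b)
                    (subst (d₁ ∣_) (trans d₁d₂≡e₁e₂ (*-comm e₁ e₂)) (m∣m*n d₂))
          e₁∣d₁ = coprime-divisor (coprime-∣ a⊥b e₁∣a d₂∣b)
                    (subst (e₁ ∣_) (trans (sym d₁d₂≡e₁e₂) (*-comm d₁ d₂)) (m∣m*n e₂))
          d₁≡e₁ = ∣-antisym d₁∣e₁ e₁∣d₁

  -- Each summand of β (a * b) factors, since λ is multiplicative on the coprime cofactors.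
  term-* : ∀ {d₁ d₂} → d₁ ∣ a → d₂ ∣ b → term (a * b) (d₁ * d₂) ≡ term a d₁ *ℤ term b d₂
  term-* {d₁} {d₂} (divides q₁ a≡q₁d₁) (divides q₂ b≡q₂d₂) = begin
      + (d₁ * d₂) *ℤ liouville (quot (a * b) (d₁ * d₂))
    ≡⟨ cong (λ q → + (d₁ * d₂) *ℤ liouville q) (quot-exact (d₁ * d₂) (*-mono-< 0<a 0<b) d₁d₂q₁q₂≡ab) ⟩
      + (d₁ * d₂) *ℤ liouville (q₁ * q₂)
    ≡⟨ cong₂ _*ℤ_ (ℤ.pos-* d₁ d₂)
                  (liouville-* (divisor-pos 0<a q₁∣a) (divisor-pos 0<b q₂∣b) (coprime-∣ a⊥b q₁∣a q₂∣b)) ⟩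
      (+ d₁ *ℤ + d₂) *ℤ (liouville q₁ *ℤ liouville q₂)
    ≡⟨ [ab][cd]≡[ac][bd]ℤ (+ d₁) (+ d₂) (liouville q₁) (liouville q₂) ⟩
      (+ d₁ *ℤ liouville q₁) *ℤ (+ d₂ *ℤ liouville q₂)
    ≡⟨ sym (cong₂ (λ r₁ r₂ → (+ d₁ *ℤ liouville r₁) *ℤ (+ d₂ *ℤ liouville r₂))
                  (quot-exact d₁ 0<a (trans (*-comm d₁ q₁) (sym a≡q₁d₁)))
                  (quot-exact d₂ 0<b (trans (*-comm d₂ q₂) (sym b≡q₂d₂)))) ⟩
      term a d₁ *ℤ term b d₂ ∎
    where
      open ≡-Reasoning
      q₁∣a = divides d₁ (trans a≡q₁d₁ (*-comm q₁ d₁))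
      q₂∣b = divides d₂ (trans b≡q₂d₂ (*-comm q₂ d₂))
      d₁d₂q₁q₂≡ab : d₁ * d₂ * (q₁ * q₂) ≡ a * b
      d₁d₂q₁q₂≡ab = trans ([ab][cd]≡[ac][bd] d₁ d₂ q₁ q₂)
        (sym (cong₂ _*_ (trans a≡q₁d₁ (*-comm q₁ d₁)) (trans b≡q₂d₂ (*-comm q₂ d₂))))

  beta-* : beta (a * b) ≡ beta a *ℤ beta b
  beta-* = begin
      beta (a * b)
    ≡⟨ sumOver-reindex (term (a * b)) _ pairs (divisors (a * b))
         (Unique.cartesianProduct⁺ (divisors-unique a) (divisors-unique b))
         (divisors-unique (a * b)) divisorPairs-bijection ⟩
      sumOver (λ d → term (a * b) (proj₁ d * proj₂ d)) pairs
    ≡⟨ sumOver-cong pairs (λ d∈ → term-* (proj₁ (∈-pairs⁻ d∈)) (proj₂ (∈-pairs⁻ d∈))) ⟩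
      sumOver (λ d → term a (proj₁ d) *ℤ term b (proj₂ d)) pairs
    ≡⟨ sumOver-cartesianProduct (term a) (term b) (divisors a) (divisors b) ⟩
      beta a *ℤ beta b ∎
    where open ≡-Reasoning

2^2^suc : ∀ m → 2 ^ 2 ^ suc m ≡ 2 ^ 2 ^ m * 2 ^ 2 ^ m
2^2^suc m = trans (cong (λ e → 2 ^ (2 ^ m + e)) (+-identityʳ (2 ^ m))) (^-distribˡ-+-* 2 (2 ^ m) (2 ^ m))

-- 2 ^ 2 ^ j ≡ 1 (mod F_i) for every j = n + i + 1 > i: the case n = 0 is (F_i - 1)², and
-- each further squaring preserves the residue 1.
fermat-residue : ∀ i n → ∃[ t ] 2 ^ 2 ^ (n + suc i) ≡ 1 + fermat i * t
fermat-residue i zero = 2 ^ 2 ^ i ∸ 1 , trans (2^2^suc i) (x²≡1+[x+1][x-1] (m^n>0 2 (2 ^ i)))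
  where
    x²≡1+[x+1][x-1] : ∀ {x} → 0 < x → x * x ≡ 1 + (x + 1) * (x ∸ 1)
    x²≡1+[x+1][x-1] {suc y} _ = identity y
      where identity : ∀ y → (1 + y) * (1 + y) ≡ 1 + (1 + y + 1) * y
            identity = solve-∀
fermat-residue i (suc n) with fermat-residue i n
... | t , x≡1+Ft = t + t + fermat i * t * t , (begin
      2 ^ 2 ^ suc (n + suc i)                                 ≡⟨ 2^2^suc (n + suc i) ⟩
      2 ^ 2 ^ (n + suc i) * 2 ^ 2 ^ (n + suc i)               ≡⟨ cong₂ _*_ x≡1+Ft x≡1+Ft ⟩
      (1 + fermat i * t) * (1 + fermat i * t)                 ≡⟨ [1+Ft]²≡1+F[2t+Ft²] (fermat i) t ⟩
      1 + fermat i * (t + t + fermat i * t * t)               ∎)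
  where
    open ≡-Reasoning
    [1+Ft]²≡1+F[2t+Ft²] : ∀ F t → (1 + F * t) * (1 + F * t) ≡ 1 + F * (t + t + F * t * t)
    [1+Ft]²≡1+F[2t+Ft²] = solve-∀

fermat-congruence : ∀ {i j} → i < j → ∃[ t ] fermat j ≡ fermat i * t + 2
fermat-congruence {i} {j} i<j with m≤n⇒∃[o]m+o≡n i<j
... | n , 1+i+n≡j with fermat-residue i n
...   | t , residue = t , (begin
      fermat j                        ≡⟨ cong fermat (trans (+-comm n (suc i)) 1+i+n≡j) ⟨
      2 ^ 2 ^ (n + suc i) + 1         ≡⟨ cong (_+ 1) residue ⟩
      1 + fermat i * t + 1            ≡⟨ cong (_+ 1) (+-comm 1 (fermat i * t)) ⟩
      fermat i * t + 1 + 1            ≡⟨ +-assoc (fermat i * t) 1 1 ⟩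
      fermat i * t + 2                ∎)
  where open ≡-Reasoning

fermat-odd : ∀ i → ¬ 2 ∣ fermat i
fermat-odd i 2∣F with ∣1⇒≡1 (∣m+n∣m⇒∣n 2∣F (∣-^ (m^n>0 2 i)))
... | ()

-- Distinct Fermat numbers are coprime: a common divisor divides 2, and F_i is odd.
fermat-coprime : ∀ {i j} → i < j → Coprime (fermat i) (fermat j)
fermat-coprime {i} {j} i<j {d} (d∣Fi , d∣Fj) with fermat-congruence i<j
... | t , Fj≡Fit+2 with prime⇒irreducible prime[2]
        (∣m+n∣m⇒∣n (subst (d ∣_) Fj≡Fit+2 d∣Fj) (∣-trans d∣Fi (m∣m*n t)))
...   | inj₁ d≡1 = d≡1
...   | inj₂ refl = ⊥-elim (fermat-odd i d∣Fi)

coprime-fermatProd : ∀ {x} k → (∀ {j} → 1 ≤ j → j < k → Coprime x (fermat j)) → Coprime x (fermatProd k)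
coprime-fermatProd zero                _      = coprime-1
coprime-fermatProd (suc zero)          _      = coprime-1
coprime-fermatProd (suc (suc k)) x⊥F =
  coprime-* (coprime-fermatProd (suc k) (λ 1≤j j<1+k → x⊥F 1≤j (m≤n⇒m≤1+n j<1+k))) (x⊥F (s≤s z≤n) ≤-refl)

SplitsOff : ℕ → ℕ → Set
SplitsOff i k = ∃[ r ] fermatProd k ≡ fermat i * r × Coprime (fermat i) r

splitsOff-last : ∀ k → SplitsOff (suc k) (suc (suc k))
splitsOff-last k = fermatProd (suc k) , *-comm (fermatProd (suc k)) (fermat (suc k)) ,
  coprime-fermatProd (suc k) (λ _ j<1+k → Coprime.sym (fermat-coprime j<1+k))

splitsOff-extend : ∀ {i} k → i < suc k → SplitsOff i (suc k) → SplitsOff i (suc (suc k))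
splitsOff-extend {i} k i<1+k (r , F≡Fi*r , Fi⊥r) = r * fermat (suc k) ,
  trans (cong (_* fermat (suc k)) F≡Fi*r) (*-assoc (fermat i) r (fermat (suc k))) ,
  coprime-* Fi⊥r (fermat-coprime i<1+k)

fermatProd-split : ∀ {i} k → 1 ≤ i → i < k → SplitsOff i k
fermatProd-split (suc zero) 1≤i (s≤s i≤0) = ⊥-elim (<⇒≱ 1≤i i≤0)
fermatProd-split {i} (suc (suc k)) 1≤i i<2+k =
  [ (λ i<1+k → splitsOff-extend k i<1+k (fermatProd-split (suc k) 1≤i i<1+k))
  , (λ i≡1+k → subst (λ j → SplitsOff j (suc (suc k))) (sym i≡1+k) (splitsOff-last k))
  ]′ (m<1+n⇒m<n∨m≡n i<2+k)

fermat-pos : ∀ j → 0 < fermat j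
fermat-pos j = m≤n+m 1 (2 ^ 2 ^ j)

fermatProd-pos : ∀ k → 0 < fermatProd k
fermatProd-pos zero          = s≤s z≤n
fermatProd-pos (suc zero)    = s≤s z≤n
fermatProd-pos (suc (suc k)) = *-mono-< (fermatProd-pos (suc k)) (fermat-pos (suc k))

m-coprime-parts : ∀ k → Coprime (2 ^ (2 ^ k ∸ 1)) (fermatProd k)
m-coprime-parts k = coprime-fermatProd k (λ {j} _ _ → primePower-coprime prime[2] (2 ^ k ∸ 1) (fermat-odd j))

m-pos : ∀ k → 0 < m k
m-pos k = *-mono-< (m^n>0 2 (2 ^ k ∸ 1)) (fermatProd-pos k)

3-coprime-m : ∀ k → Coprime 3 (m k)
3-coprime-m k = coprime-*
  (Coprime.sym (primePower-coprime prime[2] (2 ^ k ∸ 1) (fermat-odd 0)))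
  (coprime-fermatProd k (λ 1≤j _ → fermat-coprime 1≤j))

m-split : ∀ {i} k → 1 ≤ i → i < k → ∃[ r ] m k ≡ fermat i * r × Coprime (fermat i) r
m-split {i} k 1≤i i<k with fermatProd-split k 1≤i i<k
... | r , F≡Fi*r , Fi⊥r = 2 ^ (2 ^ k ∸ 1) * r ,
      trans (cong (2 ^ (2 ^ k ∸ 1) *_) F≡Fi*r) (x*[y*z]≡y*[x*z] (2 ^ (2 ^ k ∸ 1)) (fermat i) r) ,
      coprime-* (Coprime.sym (primePower-coprime prime[2] (2 ^ k ∸ 1) (fermat-odd i))) Fi⊥r

beta-prime : ∀ {p} → Prime p → beta p ≡ + (p ∸ 1)
beta-prime {suc q} pp = begin
    beta (suc q)       ≡⟨ cong beta (*-identityʳ (suc q)) ⟨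
    beta (suc q ^ 1)   ≡⟨ beta-primePower pp 1 ⟩
    altSum (suc q) 1   ≡⟨⟩
    + (q * 1 * 1 + 0)  ≡⟨ cong +_ (trans (+-identityʳ (q * 1 * 1)) (trans (*-identityʳ (q * 1)) (*-identityʳ q))) ⟩
    + q                ∎
  where open ≡-Reasoning

beta-fermat : ∀ j → Prime (fermat j) → beta (fermat j) ≡ + 2 ^ 2 ^ j
beta-fermat j pp = trans (beta-prime pp) (cong +_ (m+n∸n≡m (2 ^ 2 ^ j) 1))

-- Π_{1 ≤ j < k} 2 ^ 2 ^ j, the value of β (F_1 ⋯ F_{k-1}) when all these F_j are prime.
fermatPredProd : ℕ → ℕ
fermatPredProd zero          = 1
fermatPredProd (suc zero)    = 1
fermatPredProd (suc (suc j)) = fermatPredProd (suc j) * 2 ^ 2 ^ suc j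

FermatPrimesBelow : ℕ → Set
FermatPrimesBelow k = ∀ {j} → 1 ≤ j → j < k → Prime (fermat j)

-- β is multiplicative on the pairwise coprime F_j, and β F_j = F_j - 1 for prime F_j.
beta-fermatProd : ∀ k → FermatPrimesBelow k → beta (fermatProd k) ≡ + fermatPredProd k
beta-fermatProd zero          _      = refl
beta-fermatProd (suc zero)    _      = refl
beta-fermatProd (suc (suc k)) primes = begin
    beta (fermatProd (suc k) * fermat (suc k))
  ≡⟨ beta-* (fermatProd-pos (suc k)) (fermat-pos (suc k)) (Coprime.sym (proj₂ (proj₂ (splitsOff-last k)))) ⟩
    beta (fermatProd (suc k)) *ℤ beta (fermat (suc k))
  ≡⟨ cong₂ _*ℤ_ (beta-fermatProd (suc k) (λ 1≤j j<1+k → primes 1≤j (m≤n⇒m≤1+n j<1+k)))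
                (beta-fermat (suc k) (primes (s≤s z≤n) ≤-refl)) ⟩
    + fermatPredProd (suc k) *ℤ + 2 ^ 2 ^ suc k
  ≡⟨ ℤ.pos-* (fermatPredProd (suc k)) (2 ^ 2 ^ suc k) ⟨
    + fermatPredProd (suc (suc k)) ∎
  where open ≡-Reasoning

beta-m : ∀ k → beta (m k) ≡ beta (2 ^ (2 ^ k ∸ 1)) *ℤ beta (fermatProd k)
beta-m k = beta-* (m^n>0 2 (2 ^ k ∸ 1)) (fermatProd-pos k) (m-coprime-parts k)

-- Once F_1, …, F_{k-1} are known to be prime, whether m_k is imperfect is a finite computation.
imperfect-m-by-evaluation : ∀ k → FermatPrimesBelow k →
  + 2 *ℤ (altSum 2 (2 ^ k ∸ 1) *ℤ + fermatPredProd k) ≡ + m k → Imperfect (m k)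
imperfect-m-by-evaluation k primes evaluation = trans
  (cong (+ 2 *ℤ_) (trans (beta-m k)
    (cong₂ _*ℤ_ (beta-primePower prime[2] (2 ^ k ∸ 1)) (beta-fermatProd k primes))))
  evaluation

noDivisorUpTo : ℕ → ℕ → Bool
noDivisorUpTo n zero    = true
noDivisorUpTo n (suc r) = not ⌊ 2 + r ∣? n ⌋ ∧ noDivisorUpTo n r

noDivisorUpTo⇒rough : ∀ n r → T (noDivisorUpTo n r) → (2 + r) Rough n
noDivisorUpTo⇒rough n zero    _ = 2-rough
noDivisorUpTo⇒rough n (suc r) t with Equivalence.to T-∧ t
... | 2+r∤n , rest = ∤⇒rough-suc (toWitnessFalse 2+r∤n) (noDivisorUpTo⇒rough n r rest)

-- Trial division by 2, …, r + 1 with (r + 2)² > n certifies primality of n; used where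
-- the library's decision procedure prime? would be too slow.
prime-by-trialDivision : ∀ n r .{{_ : NonTrivial n}} →
  T (noDivisorUpTo n r) → T (n <ᵇ (2 + r) * (2 + r)) → Prime n
prime-by-trialDivision n r noDivisor bound =
  rough∧square>⇒prime (noDivisorUpTo⇒rough n r noDivisor) (<ᵇ⇒< n _ bound)

fermatPrimesBelow5 : FermatPrimesBelow 5
fermatPrimesBelow5 {1} _ _ = from-yes (prime? 5)
fermatPrimesBelow5 {2} _ _ = from-yes (prime? 17)
fermatPrimesBelow5 {3} _ _ = from-yes (prime? 257)
fermatPrimesBelow5 {4} _ _ = prime-by-trialDivision 65537 255 _ _
fermatPrimesBelow5 {suc (suc (suc (suc (suc _))))} _ (s≤s (s≤s (s≤s (s≤s (s≤s ())))))

beta-semiprime : ∀ {p q} → Prime p → Prime q → ¬ p ∣ q → beta (p * q) ≡ + (p ∸ 1) *ℤ + (q ∸ 1)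
beta-semiprime {p} {q} pp pq p∤q = trans
  (beta-* (prime>0 pp) (prime>0 pq) (Coprime.sym (prime∤⇒coprime pp p∤q)))
  (cong₂ _*ℤ_ (beta-prime pp) (beta-prime pq))
  where
    prime>0 : ∀ {n} → Prime n → 0 < n
    prime>0 pn = ≤-trans (s≤s z≤n) (2≤p pn)

-- Euler: F_5 = 641 · 6700417 with both factors prime, so β F_5 = 640 · 6700416, a multiple of 3.
-- (The arguments of beta are written out so that it is never evaluated on concrete numbers.)
3∣beta-F5 : 3 ∣ abs (beta (fermat 5))
3∣beta-F5 = subst (λ b → 3 ∣ abs b) {x = + 640 *ℤ + 6700416} {y = beta (fermat 5)} (sym beta-F5)
  (divides 1429422080 refl)
  where
    open ≡-Reasoning
    beta-F5 : beta (fermat 5) ≡ + 640 *ℤ + 6700416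
    beta-F5 = begin
        beta (fermat 5)        ≡⟨ cong beta {x = fermat 5} {y = 641 * 6700417} refl ⟩
        beta (641 * 6700417)   ≡⟨ beta-semiprime {641} {6700417} (from-yes (prime? 641))
                                    (prime-by-trialDivision 6700417 2587 _ _) (from-no (641 ∣? 6700417)) ⟩
        + 640 *ℤ + 6700416     ∎

-- If a · b is imperfect with a, b coprime, every divisor of β a divides a · b = 2 β(a) β(b).
imperfect⇒beta-∣ : ∀ a b {d} → 0 < a → 0 < b → Coprime a b → Imperfect (a * b) →
                   d ∣ abs (beta a) → d ∣ a * b
imperfect⇒beta-∣ a b {d} 0<a 0<b a⊥b imperfect d∣βa =
  subst (d ∣_) 2βaβb≡ab (∣n⇒∣m*n 2 (∣m⇒∣m*n (abs (beta b)) d∣βa))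
  where
    open ≡-Reasoning
    2βaβb≡ab : 2 * (abs (beta a) * abs (beta b)) ≡ a * b
    2βaβb≡ab = begin
      2 * (abs (beta a) * abs (beta b))  ≡⟨ cong (2 *_) (ℤ.abs-* (beta a) (beta b)) ⟨
      2 * abs (beta a *ℤ beta b)         ≡⟨ ℤ.abs-* (+ 2) (beta a *ℤ beta b) ⟨
      abs (+ 2 *ℤ (beta a *ℤ beta b))    ≡⟨ cong (λ β → abs (+ 2 *ℤ β)) (beta-* 0<a 0<b a⊥b) ⟨
      abs (+ 2 *ℤ beta (a * b))          ≡⟨ cong abs imperfect ⟩
      a * b                              ∎

fermatPrimesBelow : ∀ {k} → k ≤ 5 → FermatPrimesBelow k
fermatPrimesBelow k≤5 1≤j j<k = fermatPrimesBelow5 1≤j (<-≤-trans j<k k≤5)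

imperfect-m-small : ∀ {k} → k ≡ 2 ⊎ k ≡ 3 ⊎ k ≡ 4 ⊎ k ≡ 5 → Imperfect (m k)
imperfect-m-small (inj₁ refl) =
  imperfect-m-by-evaluation 2 (fermatPrimesBelow (≤ᵇ⇒≤ 2 5 _)) refl
imperfect-m-small (inj₂ (inj₁ refl)) =
  imperfect-m-by-evaluation 3 (fermatPrimesBelow (≤ᵇ⇒≤ 3 5 _)) refl
imperfect-m-small (inj₂ (inj₂ (inj₁ refl))) =
  imperfect-m-by-evaluation 4 (fermatPrimesBelow (≤ᵇ⇒≤ 4 5 _)) refl
imperfect-m-small (inj₂ (inj₂ (inj₂ refl))) =
  imperfect-m-by-evaluation 5 (fermatPrimesBelow (≤ᵇ⇒≤ 5 5 _)) refl

-- For k ≥ 6, F_5 splits off m_k with a coprime cofactor and 3 ∣ β F_5,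
-- so an imperfect m_k would be divisible by 3 = F_0, which is coprime to m_k.
not-imperfect-m-large : ∀ k → 6 ≤ k → ¬ Imperfect (m k)
not-imperfect-m-large k 6≤k = refute (m-split k (s≤s z≤n) 6≤k)
  where
    -- (Matching here rather than by 'with' keeps Imperfect (m k) from being normalised.)
    refute : ∃[ r ] m k ≡ fermat 5 * r × Coprime (fermat 5) r → ¬ Imperfect (m k)
    refute (r , mk≡F5*r , F5⊥r) imperfect =
      3≢1 (3-coprime-m k (∣-refl , subst (3 ∣_) (sym mk≡F5*r) 3∣F5*r))
      where
        3≢1 : ¬ 3 ≡ 1
        3≢1 ()
        0<r : 0 < r
        0<r = divisor-pos (subst (0 <_) mk≡F5*r (m-pos k)) (n∣m*n (fermat 5))
        3∣F5*r : 3 ∣ fermat 5 * r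
        3∣F5*r = imperfect⇒beta-∣ (fermat 5) r (fermat-pos 5) 0<r F5⊥r
                   (subst Imperfect {x = m k} {y = fermat 5 * r} mk≡F5*r imperfect) 3∣beta-F5

imperfect-m⇒small : ∀ k → k ≥ 2 → Imperfect (m k) → k ≡ 2 ⊎ k ≡ 3 ⊎ k ≡ 4 ⊎ k ≡ 5
imperfect-m⇒small 1 (s≤s ()) _
imperfect-m⇒small 2 _ _ = inj₁ refl
imperfect-m⇒small 3 _ _ = inj₂ (inj₁ refl)
imperfect-m⇒small 4 _ _ = inj₂ (inj₂ (inj₁ refl))
imperfect-m⇒small 5 _ _ = inj₂ (inj₂ (inj₂ refl))
imperfect-m⇒small k@(suc (suc (suc (suc (suc (suc _)))))) _ imperfect =
  ⊥-elim (not-imperfect-m-large k (s≤s (s≤s (s≤s (s≤s (s≤s (s≤s z≤n)))))) imperfect)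

mainTheorem2 : (k : ℕ) → k ≥ 2 →
    (Imperfect (m k) ⇔ (k ≡ 2 ⊎ k ≡ 3 ⊎ k ≡ 4 ⊎ k ≡ 5))
mainTheorem2 k k≥2 = mk⇔ (imperfect-m⇒small k k≥2) imperfect-m-small
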